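{- The join-irreducible elements of the lattice $C(m,n)\sqcup\{ -1\}$ (the vertices of $C(m,n)$) are exactly those good rectangular preorders $P$ in which $x\equiv_P y$ implies $x=y$. In particular, such a $P$ has $n+m-2$ equivalence classes and is a partial order.
   Context: Fix positive integers $m,n$. $\mathsf{Coll}(m,n)$ is the finite set of formal symbols $m_1,\dots,m_{m-1}$ and $l_1,\dots,l_{n-1}$. A preorder is a reflexive transitive relation $\le$; $x\equiv y$ means $x\le y$ and $y\le x$, $x<y$ means $x\le y$ but not $y\le x$, and $x,y$ are comparable if $x\le y$ or $y\le x$. Pairs $\{m_j,l_i\}$ are orthogonal; pairs $\{m_j,m_{j'}\}$ or $\{l_i,l_{i'}\}$ are parallel. Given a preorder, an orthogonal link between parallel $m_i,m_j$ is an $l_s$ with $m_i\le l_s\le m_j$ or $m_j\le l_s\le m_i$; a gap between $m_i,m_j$ is an $m_s$ with $s$ between $i$ and $j$ inclusive and $m_i<m_s$, $m_j<m_s$; links and gaps between $l_i,l_j$ are defined symmetrically. A preorder is a good rectangular preorder if (1) any two orthogonal collisions are comparable, and (2) two parallel collisions are comparable iff there is an orthogonal link between them or there is no gap between them. $C(m,n)$ is the set of good rectangular preorders ordered by refinement ($P\le Q$ iff $x\le_P y$ implies $x\le_Q y$), and $C(m,n)\sqcup\{ -1\}$ is $C(m,n)$ with a formal minimum $-1$ adjoined (it is a lattice). -}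

module Defs where

open import Data.Nat using (ℕ; pred; _≤_)
open import Data.Fin using (Fin; toℕ)
open import Data.Bool using (Bool; T)
open import Data.Sum using (_⊎_; inj₁; inj₂)
open import Data.Product using (Σ; _×_; ∃-syntax; proj₁)
open import Data.Maybe using (Maybe; just; nothing)
open import Data.Empty using (⊥)
open import Data.Unit using (⊤)
open import Relation.Nullary using (¬_)
open import Function.Bundles using (_⇔_)

-- Coll(m,n): inj₁ i is m_{i+1} (i : Fin (m-1)), inj₂ i is l_{i+1} (i : Fin (n-1)).
Coll : ℕ → ℕ → Set
Coll m n = Fin (pred m) ⊎ Fin (pred n)

-- A (decidable) binary relation on Coll(m,n); x ≤ y iff R x y = true.
-- (wrapped in a record so that m and n can be inferred)
record Rel (m n : ℕ) : Set where
  constructor mkRel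
  field
    rel : Coll m n → Coll m n → Bool
open Rel public

module _ {m n : ℕ} (R : Rel m n) where

  _≤R_ : Coll m n → Coll m n → Set
  x ≤R y = T (rel R x y)

  _≡R_ : Coll m n → Coll m n → Set
  x ≡R y = x ≤R y × y ≤R x

  _<R_ : Coll m n → Coll m n → Set
  x <R y = x ≤R y × ¬ (y ≤R x)

  Comparable : Coll m n → Coll m n → Set
  Comparable x y = x ≤R y ⊎ y ≤R x

  IsPreorderRel : Set
  IsPreorderRel = (∀ x → x ≤R x) × (∀ x y z → x ≤R y → y ≤R z → x ≤R z)

  Between : {k : ℕ} → Fin k → Fin k → Fin k → Set
  Between i j s = (toℕ i ≤ toℕ s × toℕ s ≤ toℕ j) ⊎ (toℕ j ≤ toℕ s × toℕ s ≤ toℕ i)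

  module _ {k k' : ℕ} (par : Fin k → Coll m n) (ort : Fin k' → Coll m n) where

    OrthLink : Fin k → Fin k → Set
    OrthLink i j = ∃[ s ] ((par i ≤R ort s × ort s ≤R par j) ⊎ (par j ≤R ort s × ort s ≤R par i))

    Gap : Fin k → Fin k → Set
    Gap i j = ∃[ s ] (Between i j s × par i <R par s × par j <R par s)

    ParallelCondition : Set
    ParallelCondition = ∀ i j → Comparable (par i) (par j) ⇔ (OrthLink i j ⊎ ¬ Gap i j)

  IsGoodRectangular : Set
  IsGoodRectangular =
    IsPreorderRel
    × (∀ i j → Comparable (inj₁ i) (inj₂ j))
    × ParallelCondition inj₁ inj₂
    × ParallelCondition inj₂ inj₁

C : ℕ → ℕ → Set
C m n = Σ (Rel m n) IsGoodRectangular

_⊑_ : {m n : ℕ} → C m n → C m n → Set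
P ⊑ Q = ∀ x y → _≤R_ (proj₁ P) x y → _≤R_ (proj₁ Q) x y

-- C(m,n) ⊔ {-1}, with nothing playing the role of -1
C⊥ : ℕ → ℕ → Set
C⊥ m n = Maybe (C m n)

_⊑⊥_ : {m n : ℕ} → C⊥ m n → C⊥ m n → Set
nothing ⊑⊥ _ = ⊤
just _ ⊑⊥ nothing = ⊥
just P ⊑⊥ just Q = P ⊑ Q

_≈⊥_ : {m n : ℕ} → C⊥ m n → C⊥ m n → Set
x ≈⊥ y = x ⊑⊥ y × y ⊑⊥ x

IsJoin : {m n : ℕ} → C⊥ m n → C⊥ m n → C⊥ m n → Set
IsJoin x a b = a ⊑⊥ x × b ⊑⊥ x × (∀ z → a ⊑⊥ z → b ⊑⊥ z → x ⊑⊥ z)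

JoinIrreducible : {m n : ℕ} → C⊥ m n → Set
JoinIrreducible {m} {n} x =
  ¬ (x ≈⊥ nothing) × (∀ a b → IsJoin x a b → (x ≈⊥ a) ⊎ (x ≈⊥ b))

-- An antisymmetric good preorder R is minimal in C(m,n): a good A ⊆ R keeps the orthogonal
-- comparisons of R (they are comparable in A, and antisymmetry rules out the reverse one),
-- has no gap that R lacks, and therefore keeps the parallel comparisons too; so R is an atom.
--
-- Conversely, break the ties of R along a total order of the collisions, once in each
-- direction, and trim from the results the parallel comparisons having a gap but no link.
-- The two trimmed relations are good antisymmetric relations below R, and R is their join:
-- a good Z above both inherits the comparisons of R through links, and a gap-free parallel
-- comparison of R either survives in one of them or splits, at a gap of the tie-broken
-- relation, into two closer gap-free comparisons.  Join-irreducibility then makes R equal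
-- to one of them, hence antisymmetric.

module Submission where

open import Defs
open import Data.Empty using (⊥-elim)
open import Data.Fin as Fin using (Fin; toℕ)
open import Data.Fin.Induction using (spo-noetherian)
open import Data.Fin.Properties using (toℕ-injective; any?; splitAt-join)
import Data.Fin.Properties as Finₚ
open import Data.Maybe using (just; nothing)
open import Data.Nat using (ℕ; pred; _+_; _≤_; _<_; ∣_-_∣)
open import Data.Nat.Induction using (<-wellFounded)
import Data.Nat.Properties as ℕₚ
open import Data.Product as Prod using (Σ-syntax; _×_; _,_; proj₁; proj₂)
open import Data.Sum as Sum using (_⊎_; inj₁; inj₂; swap)
open import Data.Unit using (tt)
open import Function using (_∘_; flip)
open import Function.Bundles using (_⇔_; mk⇔; Equivalence)
open import Induction.WellFounded using (Acc; acc)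
open import Relation.Binary.Definitions
  using (Transitive; Antisymmetric; Decidable; Trichotomous; Tri; tri<; tri≈; tri>)
import Relation.Binary.Construct.Flip.EqAndOrd as Flip
open import Relation.Binary.Structures using (IsStrictPartialOrder; IsStrictTotalOrder)
open import Relation.Binary.PropositionalEquality
  using (_≡_; _≢_; refl; sym; cong; resp₂; isEquivalence; module ≡-Reasoning)
open import Relation.Nullary using (¬_; Dec; yes; no)
open import Relation.Nullary.Decidable using (⌊_⌋; toWitness; fromWitness; _×-dec_; _⊎-dec_; ¬?; T?)

private variable
  m n k k′ a b c d : ℕ

infix 4 _⊢_≤_ _⊢_<_ _⊆_

_⊢_≤_ : Rel m n → Coll m n → Coll m n → Set
R ⊢ x ≤ y = _≤R_ R x y

_⊢_<_ : Rel m n → Coll m n → Coll m n → Set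
R ⊢ x < y = _<R_ R x y

_⊆_ : Rel m n → Rel m n → Set
A ⊆ B = ∀ x y → A ⊢ x ≤ y → B ⊢ x ≤ y

≤? : (R : Rel m n) → Decidable (R ⊢_≤_)
≤? R x y = T? (rel R x y)

<? : (R : Rel m n) → Decidable (R ⊢_<_)
<? R x y = ≤? R x y ×-dec ¬? (≤? R y x)

fromDec : {S : Coll m n → Coll m n → Set} → Decidable S → Rel m n
fromDec S? = mkRel (λ x y → ⌊ S? x y ⌋)

module _ {m n} {S : Coll m n → Coll m n → Set} (S? : Decidable S) where

  fromDec⁺ : ∀ {x y} → S x y → fromDec {m} {n} S? ⊢ x ≤ y
  fromDec⁺ {x} {y} = fromWitness {a? = S? x y}

  fromDec⁻ : ∀ {x y} → fromDec {m} {n} S? ⊢ x ≤ y → S x y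
  fromDec⁻ {x} {y} = toWitness {a? = S? x y}

preorder-trans : {R : Rel m n} → IsPreorderRel R → Transitive (R ⊢_≤_)
preorder-trans (_ , trans) = trans _ _ _

<-irrefl : {R : Rel m n} {x : Coll m n} → ¬ R ⊢ x < x
<-irrefl (x≤x , x≰x) = x≰x x≤x

module StrictPart (R : Rel m n) (trans : Transitive (R ⊢_≤_)) where

  ≤-<-trans : ∀ {x y z} → R ⊢ x ≤ y → R ⊢ y < z → R ⊢ x < z
  ≤-<-trans x≤y (y≤z , z≰y) = trans x≤y y≤z , λ z≤x → z≰y (trans z≤x x≤y)

  <-≤-trans : ∀ {x y z} → R ⊢ x < y → R ⊢ y ≤ z → R ⊢ x < z
  <-≤-trans (x≤y , y≰x) y≤z = trans x≤y y≤z , λ z≤x → y≰x (trans y≤z z≤x)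

  <-trans : ∀ {x y z} → R ⊢ x < y → R ⊢ y < z → R ⊢ x < z
  <-trans x<y (y≤z , _) = <-≤-trans x<y y≤z

infix 4 _∈[_,_]

_∈[_,_] : ℕ → ℕ → ℕ → Set
c ∈[ a , b ] = (a ≤ c × c ≤ b) ⊎ (b ≤ c × c ≤ a)

∈[]-swap : c ∈[ a , b ] → c ∈[ b , a ]
∈[]-swap = swap

∈[]-shrinkʳ : c ∈[ a , b ] → d ∈[ a , c ] → d ∈[ a , b ]
∈[]-shrinkʳ (inj₁ (a≤c , c≤b)) (inj₁ (a≤d , d≤c)) = inj₁ (a≤d , ℕₚ.≤-trans d≤c c≤b)
∈[]-shrinkʳ (inj₁ (a≤c , c≤b)) (inj₂ (c≤d , d≤a)) =
  inj₁ (ℕₚ.≤-trans a≤c c≤d , ℕₚ.≤-trans d≤a (ℕₚ.≤-trans a≤c c≤b))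
∈[]-shrinkʳ (inj₂ (b≤c , c≤a)) (inj₁ (a≤d , d≤c)) =
  inj₂ (ℕₚ.≤-trans b≤c (ℕₚ.≤-trans c≤a a≤d) , ℕₚ.≤-trans d≤c c≤a)
∈[]-shrinkʳ (inj₂ (b≤c , c≤a)) (inj₂ (c≤d , d≤a)) = inj₂ (ℕₚ.≤-trans b≤c c≤d , d≤a)

∈[]-shrinkˡ : c ∈[ a , b ] → d ∈[ c , b ] → d ∈[ a , b ]
∈[]-shrinkˡ c∈ab d∈cb = ∈[]-swap (∈[]-shrinkʳ (∈[]-swap c∈ab) (∈[]-swap d∈cb))

∈[]-split : ∀ d → c ∈[ a , b ] → c ∈[ a , d ] ⊎ c ∈[ d , b ]
∈[]-split {c} d (inj₁ (a≤c , c≤b)) with ℕₚ.≤-total c d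
... | inj₁ c≤d = inj₁ (inj₁ (a≤c , c≤d))
... | inj₂ d≤c = inj₂ (inj₁ (d≤c , c≤b))
∈[]-split {c} d (inj₂ (b≤c , c≤a)) with ℕₚ.≤-total c d
... | inj₁ c≤d = inj₂ (inj₂ (b≤c , c≤d))
... | inj₂ d≤c = inj₁ (inj₂ (d≤c , c≤a))

∈[a,a]⇒≡ : c ∈[ a , a ] → c ≡ a
∈[a,a]⇒≡ (inj₁ (a≤c , c≤a)) = ℕₚ.≤-antisym c≤a a≤c
∈[a,a]⇒≡ (inj₂ (a≤c , c≤a)) = ℕₚ.≤-antisym c≤a a≤c

_∈[_,_]? : ∀ c a b → Dec (c ∈[ a , b ])
c ∈[ a , b ]? = ((a ℕₚ.≤? c) ×-dec (c ℕₚ.≤? b)) ⊎-dec ((b ℕₚ.≤? c) ×-dec (c ℕₚ.≤? a))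

∣-∣-shrinkʳ : c ∈[ a , b ] → c ≢ b → ∣ a - c ∣ < ∣ a - b ∣
∣-∣-shrinkʳ (inj₁ (a≤c , c≤b)) c≢b
  rewrite ℕₚ.m≤n⇒∣m-n∣≡n∸m a≤c | ℕₚ.m≤n⇒∣m-n∣≡n∸m (ℕₚ.≤-trans a≤c c≤b) =
  ℕₚ.∸-monoˡ-< (ℕₚ.≤∧≢⇒< c≤b c≢b) a≤c
∣-∣-shrinkʳ (inj₂ (b≤c , c≤a)) c≢b
  rewrite ℕₚ.m≤n⇒∣n-m∣≡n∸m c≤a | ℕₚ.m≤n⇒∣n-m∣≡n∸m (ℕₚ.≤-trans b≤c c≤a) =
  ℕₚ.∸-monoʳ-< (ℕₚ.≤∧≢⇒< b≤c (c≢b ∘ sym)) c≤a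

∣-∣-shrinkˡ : c ∈[ a , b ] → c ≢ a → ∣ c - b ∣ < ∣ a - b ∣
∣-∣-shrinkˡ {c} {a} {b} c∈ab c≢a rewrite ℕₚ.∣-∣-comm c b | ℕₚ.∣-∣-comm a b =
  ∣-∣-shrinkʳ (∈[]-swap c∈ab) c≢a

module Family (R : Rel m n) (par : Fin k → Coll m n) (ort : Fin k′ → Coll m n) where

  Admissible : Fin k → Fin k → Set
  Admissible i j = OrthLink R par ort i j ⊎ ¬ Gap R par ort i j

  NoGap⇒Comparable : Set
  NoGap⇒Comparable = ∀ i j → ¬ Gap R par ort i j → Comparable R (par i) (par j)

  link-sym : ∀ {i j} → OrthLink R par ort i j → OrthLink R par ort j i
  link-sym (s , link) = s , swap link

  gap-sym : ∀ {i j} → Gap R par ort i j → Gap R par ort j i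
  gap-sym (s , s∈ij , i<s , j<s) = s , ∈[]-swap s∈ij , j<s , i<s

  admissible-sym : ∀ {i j} → Admissible i j → Admissible j i
  admissible-sym = Sum.map link-sym (_∘ gap-sym)

  ¬gap-refl : ∀ {i} → ¬ Gap R par ort i i
  ¬gap-refl (s , s∈ii , i<s , _) with toℕ-injective (∈[a,a]⇒≡ s∈ii)
  ... | refl = <-irrefl {R = R} i<s

  link? : ∀ i j → Dec (OrthLink R par ort i j)
  link? i j = any? λ s → (≤? R (par i) (ort s) ×-dec ≤? R (ort s) (par j))
                     ⊎-dec (≤? R (par j) (ort s) ×-dec ≤? R (ort s) (par i))

  gap? : ∀ i j → Dec (Gap R par ort i j)
  gap? i j = any? λ s → (toℕ s ∈[ toℕ i , toℕ j ]?)
                     ×-dec (<? R (par i) (par s) ×-dec <? R (par j) (par s))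

  admissible? : ∀ i j → Dec (Admissible i j)
  admissible? i j = link? i j ⊎-dec ¬? (gap? i j)

  module _ (trans : Transitive (R ⊢_≤_)) where
    open StrictPart R trans

    link-oriented : ∀ {i j} → R ⊢ par i ≤ par j → OrthLink R par ort i j →
                    Σ[ s ∈ Fin k′ ] (R ⊢ par i ≤ ort s × R ⊢ ort s ≤ par j)
    link-oriented _ (s , inj₁ i≤s≤j) = s , i≤s≤j
    link-oriented i≤j (s , inj₂ (j≤s , s≤i)) = s , trans i≤j j≤s , trans s≤i i≤j

    admissible-trans : ∀ {i j l} → R ⊢ par i ≤ par j → R ⊢ par j ≤ par l →
                       Admissible i j → Admissible j l → Admissible i l
    admissible-trans i≤j j≤l (inj₁ link) _ with link-oriented i≤j link
    ... | s , i≤s , s≤j = inj₁ (s , inj₁ (i≤s , trans s≤j j≤l))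
    admissible-trans i≤j j≤l (inj₂ _) (inj₁ link) with link-oriented j≤l link
    ... | s , j≤s , s≤l = inj₁ (s , inj₁ (trans i≤j j≤s , s≤l))
    admissible-trans {i} {j} {l} i≤j j≤l (inj₂ ¬gap-ij) (inj₂ ¬gap-jl) = inj₂ ¬gap-il
      where
      ¬gap-il : ¬ Gap R par ort i l
      ¬gap-il (s , s∈il , i<s , l<s) with ∈[]-split (toℕ j) s∈il
      ... | inj₁ s∈ij = ¬gap-ij (s , s∈ij , i<s , ≤-<-trans j≤l l<s)
      ... | inj₂ s∈jl = ¬gap-jl (s , s∈jl , ≤-<-trans j≤l l<s , l<s)

    ¬gap-shrinkʳ : ∀ {i j s} → R ⊢ par j ≤ par s → ¬ Gap R par ort i j →
                   toℕ s ∈[ toℕ i , toℕ j ] → ¬ Gap R par ort i s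
    ¬gap-shrinkʳ j≤s ¬gap s∈ij (t , t∈is , i<t , s<t) =
      ¬gap (t , ∈[]-shrinkʳ s∈ij t∈is , i<t , ≤-<-trans j≤s s<t)

    ¬gap-shrinkˡ : ∀ {i j s} → R ⊢ par i ≤ par j → ¬ Gap R par ort i j →
                   toℕ s ∈[ toℕ i , toℕ j ] → ¬ Gap R par ort s j
    ¬gap-shrinkˡ i≤j ¬gap s∈ij (t , t∈sj , s<t , j<t) =
      ¬gap (t , ∈[]-shrinkˡ s∈ij t∈sj , ≤-<-trans i≤j j<t , j<t)

    ¬gap-above⇒≤ : ∀ {i j s} → R ⊢ par i ≤ par j → ¬ Gap R par ort i j →
                   toℕ s ∈[ toℕ i , toℕ j ] →
                   R ⊢ par i ≤ par s → R ⊢ par j ≤ par s → R ⊢ par s ≤ par j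
    ¬gap-above⇒≤ {i} {j} {s} i≤j ¬gap s∈ij i≤s j≤s
      with ≤? R (par s) (par j) | ≤? R (par s) (par i)
    ... | yes s≤j | _ = s≤j
    ... | no _ | yes s≤i = trans s≤i i≤j
    ... | no s≰j | no s≰i = ⊥-elim (¬gap (s , s∈ij , (i≤s , s≰i) , (j≤s , s≰j)))

    parallel-⊆ : ParallelCondition R par ort → (Z : Rel m n) → Transitive (Z ⊢_≤_) →
                 (∀ {i s} → R ⊢ par i ≤ ort s → Z ⊢ par i ≤ ort s) →
                 (∀ {s i} → R ⊢ ort s ≤ par i → Z ⊢ ort s ≤ par i) →
                 (∀ {i j} → R ⊢ par i ≤ par j → ¬ Gap R par ort i j → Z ⊢ par i ≤ par j) →
                 ∀ {i j} → R ⊢ par i ≤ par j → Z ⊢ par i ≤ par j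
    parallel-⊆ parallel Z Z-trans po⊆ op⊆ noGap⊆ {i} {j} i≤j
      with Equivalence.to (parallel i j) (inj₁ i≤j)
    ... | inj₂ ¬gap = noGap⊆ i≤j ¬gap
    ... | inj₁ link with link-oriented i≤j link
    ...   | s , i≤s , s≤j = Z-trans (po⊆ i≤s) (op⊆ s≤j)

module NoGapCover
  (R Z : Rel m n) (par : Fin k → Coll m n) (ort : Fin k′ → Coll m n)
  (R-trans : Transitive (R ⊢_≤_)) (Z-trans : Transitive (Z ⊢_≤_))
  (cover : ∀ {i j} → R ⊢ par i ≤ par j →
           Σ[ L ∈ Rel m n ] (L ⊆ R × (¬ Gap L par ort i j → Z ⊢ par i ≤ par j)))
  where
  open Family R par ort

  -- A gap of the covering relation L splits the pair into two closer gap-free pairs of R.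
  noGap-⊆-acc : ∀ i j → Acc _<_ ∣ toℕ i - toℕ j ∣ →
                R ⊢ par i ≤ par j → ¬ Gap R par ort i j → Z ⊢ par i ≤ par j
  noGap-⊆-acc i j (acc closer) i≤j ¬gap with cover i≤j
  ... | L , L⊆R , noGapL⊆ with Family.gap? L par ort i j
  ...   | no ¬gapL = noGapL⊆ ¬gapL
  ...   | yes (s , s∈ij , i<s , j<s) = Z-trans
    (noGap-⊆-acc i s (closer (∣-∣-shrinkʳ s∈ij (distinct j<s))) i≤s
      (¬gap-shrinkʳ R-trans j≤s ¬gap s∈ij))
    (noGap-⊆-acc s j (closer (∣-∣-shrinkˡ s∈ij (distinct i<s))) s≤j
      (¬gap-shrinkˡ R-trans i≤j ¬gap s∈ij))
    where
    distinct : ∀ {t} → L ⊢ par t < par s → toℕ s ≢ toℕ t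
    distinct t<s eq with toℕ-injective eq
    ... | refl = <-irrefl {R = L} t<s

    i≤s : R ⊢ par i ≤ par s
    i≤s = L⊆R _ _ (proj₁ i<s)

    j≤s : R ⊢ par j ≤ par s
    j≤s = L⊆R _ _ (proj₁ j<s)

    s≤j : R ⊢ par s ≤ par j
    s≤j = ¬gap-above⇒≤ R-trans i≤j ¬gap s∈ij i≤s j≤s

  noGap-⊆ : ∀ {i j} → R ⊢ par i ≤ par j → ¬ Gap R par ort i j → Z ⊢ par i ≤ par j
  noGap-⊆ {i} {j} = noGap-⊆-acc i j (<-wellFounded _)

Trimmed : Rel m n → Coll m n → Coll m n → Set
Trimmed Q (inj₁ i) (inj₁ j) = Q ⊢ inj₁ i ≤ inj₁ j × Family.Admissible Q inj₁ inj₂ i j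
Trimmed Q (inj₂ i) (inj₂ j) = Q ⊢ inj₂ i ≤ inj₂ j × Family.Admissible Q inj₂ inj₁ i j
Trimmed Q (inj₁ i) (inj₂ j) = Q ⊢ inj₁ i ≤ inj₂ j
Trimmed Q (inj₂ i) (inj₁ j) = Q ⊢ inj₂ i ≤ inj₁ j

trimmed? : (Q : Rel m n) → Decidable (Trimmed Q)
trimmed? Q (inj₁ i) (inj₁ j) = ≤? Q _ _ ×-dec Family.admissible? Q inj₁ inj₂ i j
trimmed? Q (inj₂ i) (inj₂ j) = ≤? Q _ _ ×-dec Family.admissible? Q inj₂ inj₁ i j
trimmed? Q (inj₁ i) (inj₂ j) = ≤? Q _ _
trimmed? Q (inj₂ i) (inj₁ j) = ≤? Q _ _

trim : Rel m n → Rel m n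
trim {m} {n} Q = fromDec {m} {n} (trimmed? Q)

module _ (Q : Rel m n) where

  trim⁺ : ∀ x y → Trimmed Q x y → trim Q ⊢ x ≤ y
  trim⁺ x y = fromDec⁺ {m} {n} (trimmed? Q) {x} {y}

  trim⁻ : ∀ x y → trim Q ⊢ x ≤ y → Trimmed Q x y
  trim⁻ x y = fromDec⁻ {m} {n} (trimmed? Q) {x} {y}

  trim-⊆ : trim Q ⊆ Q
  trim-⊆ (inj₁ i) (inj₁ j) = proj₁ ∘ trim⁻ (inj₁ i) (inj₁ j)
  trim-⊆ (inj₂ i) (inj₂ j) = proj₁ ∘ trim⁻ (inj₂ i) (inj₂ j)
  trim-⊆ (inj₁ i) (inj₂ j) = trim⁻ (inj₁ i) (inj₂ j)
  trim-⊆ (inj₂ i) (inj₁ j) = trim⁻ (inj₂ i) (inj₁ j)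

module TrimFamily
  (Q : Rel m n) (par : Fin k → Coll m n) (ort : Fin k′ → Coll m n) (trans : Transitive (Q ⊢_≤_))
  (trim-par⁺ : ∀ {i j} → Q ⊢ par i ≤ par j → Family.Admissible Q par ort i j →
               trim Q ⊢ par i ≤ par j)
  (trim-par⁻ : ∀ {i j} → trim Q ⊢ par i ≤ par j → Family.Admissible Q par ort i j)
  (trim-po⁺ : ∀ {i s} → Q ⊢ par i ≤ ort s → trim Q ⊢ par i ≤ ort s)
  (trim-op⁺ : ∀ {s i} → Q ⊢ ort s ≤ par i → trim Q ⊢ ort s ≤ par i)
  where
  open Family Q par ort
  open StrictPart Q trans
  module TQ = Family (trim Q) par ort

  private
    ⊆Q : ∀ {x y} → trim Q ⊢ x ≤ y → Q ⊢ x ≤ y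
    ⊆Q = trim-⊆ Q _ _

  trim-trans : ∀ {i j l} → trim Q ⊢ par i ≤ par j → trim Q ⊢ par j ≤ par l →
               trim Q ⊢ par i ≤ par l
  trim-trans i≤j j≤l = trim-par⁺ (trans (⊆Q i≤j) (⊆Q j≤l))
    (admissible-trans trans (⊆Q i≤j) (⊆Q j≤l) (trim-par⁻ i≤j) (trim-par⁻ j≤l))

  trim-via-ort : ∀ {i j s} → Q ⊢ par i ≤ ort s → Q ⊢ ort s ≤ par j → trim Q ⊢ par i ≤ par j
  trim-via-ort {s = s} i≤s s≤j = trim-par⁺ (trans i≤s s≤j) (inj₁ (s , inj₁ (i≤s , s≤j)))

  trim-refl : (∀ x → Q ⊢ x ≤ x) → ∀ {i} → trim Q ⊢ par i ≤ par i
  trim-refl reflexive = trim-par⁺ (reflexive _) (inj₂ ¬gap-refl)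

  link-trim⁺ : ∀ {i j} → OrthLink Q par ort i j → OrthLink (trim Q) par ort i j
  link-trim⁺ (s , link) = s , Sum.map (Prod.map trim-po⁺ trim-op⁺) (Prod.map trim-po⁺ trim-op⁺) link

  link-trim⁻ : ∀ {i j} → OrthLink (trim Q) par ort i j → OrthLink Q par ort i j
  link-trim⁻ (s , link) = s , Sum.map (Prod.map ⊆Q ⊆Q) (Prod.map ⊆Q ⊆Q) link

  trim-strict⁺ : ∀ {i s} → Q ⊢ par i < par s → ¬ Gap Q par ort i s → trim Q ⊢ par i < par s
  trim-strict⁺ (i≤s , s≰i) ¬gap = trim-par⁺ i≤s (inj₂ ¬gap) , s≰i ∘ ⊆Q

  trim-strict⁻ : ∀ {i s} → trim Q ⊢ par i < par s → Q ⊢ par i < par s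
  trim-strict⁻ (i≤s , s≰i) =
    ⊆Q i≤s , λ s≤i → s≰i (trim-par⁺ s≤i (admissible-sym (trim-par⁻ i≤s)))

  gap-trim⁻ : ∀ {i j} → Gap (trim Q) par ort i j → Gap Q par ort i j
  gap-trim⁻ (s , s∈ij , i<s , j<s) = s , s∈ij , trim-strict⁻ i<s , trim-strict⁻ j<s

  Below : Fin k → Fin k → Set
  Below s t = Q ⊢ par s < par t

  below-isStrictPartialOrder : IsStrictPartialOrder _≡_ Below
  below-isStrictPartialOrder = record
    { isEquivalence = isEquivalence
    ; irrefl = λ { refl → <-irrefl {R = Q} }
    ; trans = <-trans
    ; <-resp-≈ = resp₂ Below
    }

  -- A gap of Q either survives trimming or contains a strictly higher gap of Q;
  -- finiteness of the index set stops the ascent.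
  gap-trim⁺-from : ∀ {i j} s → Acc (flip Below) s → toℕ s ∈[ toℕ i , toℕ j ] →
                   Q ⊢ par i < par s → Q ⊢ par j < par s → Gap (trim Q) par ort i j
  gap-trim⁺-from {i} {j} s (acc above) s∈ij i<s j<s with gap? i s | gap? j s
  ... | yes (t , t∈is , i<t , s<t) | _ =
    gap-trim⁺-from t (above s<t) (∈[]-shrinkʳ s∈ij t∈is) i<t (<-trans j<s s<t)
  ... | no _ | yes (t , t∈js , j<t , s<t) =
    gap-trim⁺-from t (above s<t) (∈[]-shrinkˡ s∈ij (∈[]-swap t∈js)) (<-trans i<s s<t) j<t
  ... | no ¬gap-is | no ¬gap-js = s , s∈ij , trim-strict⁺ i<s ¬gap-is , trim-strict⁺ j<s ¬gap-js

  gap-trim⁺ : ∀ {i j} → Gap Q par ort i j → Gap (trim Q) par ort i j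
  gap-trim⁺ (s , s∈ij , i<s , j<s) =
    gap-trim⁺-from s (spo-noetherian below-isStrictPartialOrder s) s∈ij i<s j<s

  admissible-trim⁺ : ∀ {i j} → Admissible i j → TQ.Admissible i j
  admissible-trim⁺ = Sum.map link-trim⁺ (_∘ gap-trim⁻)

  trim-parallel : NoGap⇒Comparable → ParallelCondition (trim Q) par ort
  trim-parallel noGap⇒comparable i j = mk⇔ to from
    where
    to : Comparable (trim Q) (par i) (par j) → TQ.Admissible i j
    to (inj₁ i≤j) = admissible-trim⁺ (trim-par⁻ i≤j)
    to (inj₂ j≤i) = TQ.admissible-sym (admissible-trim⁺ (trim-par⁻ j≤i))

    from : TQ.Admissible i j → Comparable (trim Q) (par i) (par j)
    from (inj₁ link) with link-trim⁻ link
    ... | s , inj₁ (i≤s , s≤j) = inj₁ (trim-via-ort i≤s s≤j)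
    ... | s , inj₂ (j≤s , s≤i) = inj₂ (trim-via-ort j≤s s≤i)
    from (inj₂ ¬gap-trim) =
      Sum.map (λ i≤j → trim-par⁺ i≤j (inj₂ ¬gap))
              (λ j≤i → trim-par⁺ j≤i (inj₂ (¬gap ∘ gap-sym)))
              (noGap⇒comparable i j ¬gap)
      where
      ¬gap : ¬ Gap Q par ort i j
      ¬gap = ¬gap-trim ∘ gap-trim⁺

trim-isGood : {Q : Rel m n} → IsPreorderRel Q → (∀ i j → Comparable Q (inj₁ i) (inj₂ j)) →
              Family.NoGap⇒Comparable Q inj₁ inj₂ → Family.NoGap⇒Comparable Q inj₂ inj₁ →
              IsGoodRectangular (trim Q)
trim-isGood {Q = Q} (reflexive , transitive) orthogonal noGap₁ noGap₂ =
  (trim-reflexive , trim-transitive) , trim-orthogonal ,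
  F₁.trim-parallel noGap₁ , F₂.trim-parallel noGap₂
  where
  trans : Transitive (Q ⊢_≤_)
  trans = transitive _ _ _

  module F₁ = TrimFamily Q inj₁ inj₂ trans
    (λ {i j} i≤j adm → trim⁺ Q (inj₁ i) (inj₁ j) (i≤j , adm))
    (λ {i j} → proj₂ ∘ trim⁻ Q (inj₁ i) (inj₁ j))
    (λ {i s} → trim⁺ Q (inj₁ i) (inj₂ s)) (λ {s i} → trim⁺ Q (inj₂ s) (inj₁ i))
  module F₂ = TrimFamily Q inj₂ inj₁ trans
    (λ {i j} i≤j adm → trim⁺ Q (inj₂ i) (inj₂ j) (i≤j , adm))
    (λ {i j} → proj₂ ∘ trim⁻ Q (inj₂ i) (inj₂ j))
    (λ {i s} → trim⁺ Q (inj₂ i) (inj₁ s)) (λ {s i} → trim⁺ Q (inj₁ s) (inj₂ i))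

  trim-reflexive : ∀ x → trim Q ⊢ x ≤ x
  trim-reflexive (inj₁ _) = F₁.trim-refl reflexive
  trim-reflexive (inj₂ _) = F₂.trim-refl reflexive

  ⊆Q : ∀ {x y} → trim Q ⊢ x ≤ y → Q ⊢ x ≤ y
  ⊆Q = trim-⊆ Q _ _

  via-Q : ∀ x y z → trim Q ⊢ x ≤ y → trim Q ⊢ y ≤ z → Q ⊢ x ≤ z
  via-Q x y z x≤y y≤z = transitive x y z (trim-⊆ Q x y x≤y) (trim-⊆ Q y z y≤z)

  trim-transitive : ∀ x y z → trim Q ⊢ x ≤ y → trim Q ⊢ y ≤ z → trim Q ⊢ x ≤ z
  trim-transitive (inj₁ _) (inj₁ _) (inj₁ _) x≤y y≤z = F₁.trim-trans x≤y y≤z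
  trim-transitive (inj₂ _) (inj₂ _) (inj₂ _) x≤y y≤z = F₂.trim-trans x≤y y≤z
  trim-transitive (inj₁ _) (inj₂ _) (inj₁ _) x≤y y≤z = F₁.trim-via-ort (⊆Q x≤y) (⊆Q y≤z)
  trim-transitive (inj₂ _) (inj₁ _) (inj₂ _) x≤y y≤z = F₂.trim-via-ort (⊆Q x≤y) (⊆Q y≤z)
  trim-transitive x@(inj₁ _) y z@(inj₂ _) x≤y y≤z = trim⁺ Q x z (via-Q x y z x≤y y≤z)
  trim-transitive x@(inj₂ _) y z@(inj₁ _) x≤y y≤z = trim⁺ Q x z (via-Q x y z x≤y y≤z)

  trim-orthogonal : ∀ i j → Comparable (trim Q) (inj₁ i) (inj₂ j)
  trim-orthogonal i j =
    Sum.map (trim⁺ Q (inj₁ i) (inj₂ j)) (trim⁺ Q (inj₂ j) (inj₁ i)) (orthogonal i j)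

module _ {_≺_ : Coll m n → Coll m n → Set} (σ : IsStrictTotalOrder _≡_ _≺_) where
  private
    module ≺ = IsStrictTotalOrder σ

  TiesBroken : Rel m n → Coll m n → Coll m n → Set
  TiesBroken P u v = P ⊢ u ≤ v × ¬ (P ⊢ v ≤ u × v ≺ u)

  tiesBroken? : (P : Rel m n) → Decidable (TiesBroken P)
  tiesBroken? P u v = ≤? P u v ×-dec ¬? (≤? P v u ×-dec (v ≺.<? u))

  breakTies : Rel m n → Rel m n
  breakTies P = fromDec {m} {n} (tiesBroken? P)

  ≺-negatedTrans : ∀ {x y z} → ¬ y ≺ x → ¬ z ≺ y → ¬ z ≺ x
  ≺-negatedTrans {x} {y} {z} y⊀x z⊀y z≺x with ≺.compare z y
  ... | tri< z≺y _ _ = z⊀y z≺y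
  ... | tri≈ _ refl _ = y⊀x z≺x
  ... | tri> _ _ y≺z = y⊀x (≺.trans y≺z z≺x)

  module _ (P : Rel m n) where

    breakTies⁺ : ∀ {u v} → TiesBroken P u v → breakTies P ⊢ u ≤ v
    breakTies⁺ {u} {v} = fromDec⁺ {m} {n} (tiesBroken? P) {u} {v}

    breakTies⁻ : ∀ {u v} → breakTies P ⊢ u ≤ v → TiesBroken P u v
    breakTies⁻ {u} {v} = fromDec⁻ {m} {n} (tiesBroken? P) {u} {v}

    breakTies-⊆ : breakTies P ⊆ P
    breakTies-⊆ _ _ = proj₁ ∘ breakTies⁻

    breakTies-antisym : Antisymmetric _≡_ (breakTies P ⊢_≤_)
    breakTies-antisym {u} {v} u≤v v≤u = by-cases (≺.compare u v)
      where
      by-cases : Tri (u ≺ v) (u ≡ v) (v ≺ u) → u ≡ v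
      by-cases (tri< u≺v _ _) = ⊥-elim (proj₂ (breakTies⁻ v≤u) (breakTies-⊆ u v u≤v , u≺v))
      by-cases (tri≈ _ u≡v _) = u≡v
      by-cases (tri> _ _ v≺u) = ⊥-elim (proj₂ (breakTies⁻ u≤v) (breakTies-⊆ v u v≤u , v≺u))

    breakTies-comparable : ∀ {u v} → Comparable P u v → Comparable (breakTies P) u v
    breakTies-comparable = Sum.[ below , swap ∘ below ]
      where
      below : ∀ {u v} → P ⊢ u ≤ v → Comparable (breakTies P) u v
      below {u} {v} u≤v = by-cases (v ≺.<? u) (≤? P v u)
        where
        by-cases : Dec (v ≺ u) → Dec (P ⊢ v ≤ u) → Comparable (breakTies P) u v
        by-cases (no v⊀u) _ = inj₁ (breakTies⁺ (u≤v , v⊀u ∘ proj₂))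
        by-cases (yes v≺u) (yes v≤u) = inj₂ (breakTies⁺ (v≤u , ≺.asym v≺u ∘ proj₂))
        by-cases (yes _) (no v≰u) = inj₁ (breakTies⁺ (u≤v , v≰u ∘ proj₁))

    breakTies-strict : ∀ {u v} → P ⊢ u < v → breakTies P ⊢ u < v
    breakTies-strict (u≤v , v≰u) = breakTies⁺ (u≤v , v≰u ∘ proj₁) , v≰u ∘ proj₁ ∘ breakTies⁻

    breakTies-isPreorder : IsPreorderRel P → IsPreorderRel (breakTies P)
    breakTies-isPreorder (reflexive , transitive) = reflexive′ , transitive′
      where
      reflexive′ : ∀ u → breakTies P ⊢ u ≤ u
      reflexive′ u = breakTies⁺ (reflexive u , ≺.irrefl refl ∘ proj₂)

      transitive′ : ∀ u v w → breakTies P ⊢ u ≤ v → breakTies P ⊢ v ≤ w → breakTies P ⊢ u ≤ w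
      transitive′ u v w u≤v v≤w with breakTies⁻ u≤v | breakTies⁻ v≤w
      ... | Puv , ¬vu | Pvw , ¬wv = breakTies⁺ (transitive u v w Puv Pvw , ¬wu)
        where
        ¬wu : ¬ (P ⊢ w ≤ u × w ≺ u)
        ¬wu (Pwu , w≺u) = ≺-negatedTrans (λ v≺u → ¬vu (transitive v w u Pvw Pwu , v≺u))
                                         (λ w≺v → ¬wv (transitive w u v Pwu Puv , w≺v)) w≺u

    breakTies-noGap : ∀ {k k′} {par : Fin k → Coll m n} {ort : Fin k′ → Coll m n} →
                      ParallelCondition P par ort → Family.NoGap⇒Comparable (breakTies P) par ort
    breakTies-noGap {par = par} {ort} parallel i j ¬gap =
      breakTies-comparable (Equivalence.from (parallel i j) (inj₂ (¬gap ∘ gap-breakTies)))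
      where
      gap-breakTies : Gap P par ort i j → Gap (breakTies P) par ort i j
      gap-breakTies (s , s∈ij , i<s , j<s) = s , s∈ij , breakTies-strict i<s , breakTies-strict j<s

    trim-breakTies-isGood : IsGoodRectangular P → IsGoodRectangular (trim (breakTies P))
    trim-breakTies-isGood (pre , orthogonal , parallel₁ , parallel₂) =
      trim-isGood {Q = breakTies P} (breakTies-isPreorder pre)
        (λ i j → breakTies-comparable (orthogonal i j))
        (breakTies-noGap parallel₁) (breakTies-noGap parallel₂)

breakTies-cover : {_≺_ : Coll m n → Coll m n → Set} (σ : IsStrictTotalOrder _≡_ _≺_)
                  (P : Rel m n) →
                  ∀ {u v} → P ⊢ u ≤ v →
                  breakTies σ P ⊢ u ≤ v ⊎ breakTies (Flip.isStrictTotalOrder σ) P ⊢ u ≤ v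
breakTies-cover {_≺_ = _≺_} σ P {u} {v} u≤v = by-cases (IsStrictTotalOrder._<?_ σ v u)
  where
  by-cases : Dec (v ≺ u) →
             breakTies σ P ⊢ u ≤ v ⊎ breakTies (Flip.isStrictTotalOrder σ) P ⊢ u ≤ v
  by-cases (no v⊀u) = inj₁ (breakTies⁺ σ P (u≤v , v⊀u ∘ proj₂))
  by-cases (yes v≺u) =
    inj₂ (breakTies⁺ (Flip.isStrictTotalOrder σ) P (u≤v , IsStrictTotalOrder.asym σ v≺u ∘ proj₂))

module _ {R A : Rel m n} (R-antisym : Antisymmetric _≡_ (R ⊢_≤_)) (A⊆R : A ⊆ R)
         (A-refl : ∀ x → A ⊢ x ≤ x) where

  ⊆-comparable⇒≤ : ∀ {x y} → Comparable A x y → R ⊢ x ≤ y → A ⊢ x ≤ y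
  ⊆-comparable⇒≤ (inj₁ x≤y) _ = x≤y
  ⊆-comparable⇒≤ {x} (inj₂ y≤x) x≤y with R-antisym x≤y (A⊆R _ _ y≤x)
  ... | refl = A-refl x

  ⊆-strict : ∀ {x y} → A ⊢ x < y → R ⊢ x < y
  ⊆-strict {x} {y} (x≤y , y≰x) = A⊆R _ _ x≤y , y≰x ∘ ⊆-comparable⇒≤ (inj₂ x≤y)

  ⊆-noGap⇒≤ : ∀ {k k′} {par : Fin k → Coll m n} {ort : Fin k′ → Coll m n} →
              ParallelCondition A par ort →
            ∀ {i j} → R ⊢ par i ≤ par j → ¬ Gap R par ort i j → A ⊢ par i ≤ par j
  ⊆-noGap⇒≤ {par = par} {ort} A-parallel {i} {j} i≤j ¬gap =
    ⊆-comparable⇒≤ (Equivalence.from (A-parallel i j) (inj₂ (¬gap ∘ gap-⊆))) i≤j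
    where
    gap-⊆ : Gap A par ort i j → Gap R par ort i j
    gap-⊆ (s , s∈ij , i<s , j<s) = s , s∈ij , ⊆-strict i<s , ⊆-strict j<s

antisym⇒minimal : {R A : Rel m n} → IsGoodRectangular R → Antisymmetric _≡_ (R ⊢_≤_) →
                  IsGoodRectangular A → A ⊆ R → R ⊆ A
antisym⇒minimal {R = R} {A} (R-pre , _ , R-parallel₁ , R-parallel₂) R-antisym
  ((A-refl , A-trans) , A-orthogonal , A-parallel₁ , A-parallel₂) A⊆R = R⊆A
  where
  R-trans : Transitive (R ⊢_≤_)
  R-trans = preorder-trans {R = R} R-pre

  orthogonal₁₂ : ∀ {i j} → R ⊢ inj₁ i ≤ inj₂ j → A ⊢ inj₁ i ≤ inj₂ j
  orthogonal₁₂ {i} {j} = ⊆-comparable⇒≤ {R = R} {A} R-antisym A⊆R A-refl (A-orthogonal i j)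

  orthogonal₂₁ : ∀ {i j} → R ⊢ inj₂ i ≤ inj₁ j → A ⊢ inj₂ i ≤ inj₁ j
  orthogonal₂₁ {i} {j} = ⊆-comparable⇒≤ {R = R} {A} R-antisym A⊆R A-refl (swap (A-orthogonal j i))

  R⊆A : R ⊆ A
  R⊆A (inj₁ _) (inj₁ _) =
    Family.parallel-⊆ R inj₁ inj₂ R-trans R-parallel₁ A (λ {x y z} → A-trans x y z) orthogonal₁₂ orthogonal₂₁
      (⊆-noGap⇒≤ {R = R} {A} R-antisym A⊆R A-refl A-parallel₁)
  R⊆A (inj₂ _) (inj₂ _) =
    Family.parallel-⊆ R inj₂ inj₁ R-trans R-parallel₂ A (λ {x y z} → A-trans x y z) orthogonal₂₁ orthogonal₁₂
      (⊆-noGap⇒≤ {R = R} {A} R-antisym A⊆R A-refl A-parallel₂)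
  R⊆A (inj₁ _) (inj₂ _) = orthogonal₁₂
  R⊆A (inj₂ _) (inj₁ _) = orthogonal₂₁

module _ {m n : ℕ} where
  private
    index : Coll m n → Fin (pred m + pred n)
    index = Fin.join (pred m) (pred n)

    index-injective : ∀ {x y} → index x ≡ index y → x ≡ y
    index-injective {x} {y} eq = begin
      x                                ≡⟨ splitAt-join (pred m) (pred n) x ⟨
      Fin.splitAt (pred m) (index x)   ≡⟨ cong (Fin.splitAt (pred m)) eq ⟩
      Fin.splitAt (pred m) (index y)   ≡⟨ splitAt-join (pred m) (pred n) y ⟩
      y                                ∎
      where open ≡-Reasoning

  _≺_ : Coll m n → Coll m n → Set
  x ≺ y = index x Fin.< index y

  ≺-compare : Trichotomous _≡_ _≺_
  ≺-compare x y with Finₚ.<-cmp (index x) (index y)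
  ... | tri< x≺y x≢y y⊀x = tri< x≺y (x≢y ∘ cong index) y⊀x
  ... | tri≈ x⊀y x≡y y⊀x = tri≈ x⊀y (index-injective x≡y) y⊀x
  ... | tri> x⊀y x≢y y≺x = tri> x⊀y (x≢y ∘ cong index) y≺x

  ≺-isStrictTotalOrder : IsStrictTotalOrder _≡_ _≺_
  ≺-isStrictTotalOrder = record
    { isStrictPartialOrder = record
      { isEquivalence = isEquivalence
      ; irrefl = λ { refl → Finₚ.<-irrefl refl }
      ; trans = Finₚ.<-trans
      ; <-resp-≈ = resp₂ _≺_
      }
    ; compare = ≺-compare
    }

module _ {_≺_ : Coll m n → Coll m n → Set} (σ : IsStrictTotalOrder _≡_ _≺_) where
  private
    σ′ = Flip.isStrictTotalOrder σ

  breakTies-least : {R Z : Rel m n} → IsGoodRectangular R → IsGoodRectangular Z →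
                    trim (breakTies σ R) ⊆ Z → trim (breakTies σ′ R) ⊆ Z → R ⊆ Z
  breakTies-least {R} {Z} (R-pre , _ , R-parallel₁ , R-parallel₂) (Z-pre , _) A⊆Z B⊆Z = R⊆Z
    where
    R-trans : Transitive (R ⊢_≤_)
    R-trans = preorder-trans {R = R} R-pre

    Z-trans : Transitive (Z ⊢_≤_)
    Z-trans = preorder-trans {R = Z} Z-pre

    orthogonal₁₂ : ∀ {i j} → R ⊢ inj₁ i ≤ inj₂ j → Z ⊢ inj₁ i ≤ inj₂ j
    orthogonal₁₂ {i} {j} = Sum.[ A⊆Z _ _ ∘ trim⁺ (breakTies σ R) (inj₁ i) (inj₂ j)
                               , B⊆Z _ _ ∘ trim⁺ (breakTies σ′ R) (inj₁ i) (inj₂ j) ]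
                         ∘ breakTies-cover σ R

    orthogonal₂₁ : ∀ {i j} → R ⊢ inj₂ i ≤ inj₁ j → Z ⊢ inj₂ i ≤ inj₁ j
    orthogonal₂₁ {i} {j} = Sum.[ A⊆Z _ _ ∘ trim⁺ (breakTies σ R) (inj₂ i) (inj₁ j)
                               , B⊆Z _ _ ∘ trim⁺ (breakTies σ′ R) (inj₂ i) (inj₁ j) ]
                         ∘ breakTies-cover σ R

    cover₁ : ∀ {i j} → R ⊢ inj₁ i ≤ inj₁ j →
             Σ[ L ∈ Rel m n ] (L ⊆ R × (¬ Gap L inj₁ inj₂ i j → Z ⊢ inj₁ i ≤ inj₁ j))
    cover₁ {i} {j} = Sum.[ via (breakTies-⊆ σ R) A⊆Z , via (breakTies-⊆ σ′ R) B⊆Z ]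
                   ∘ breakTies-cover σ R
      where
      via : ∀ {L} → L ⊆ R → trim L ⊆ Z → L ⊢ inj₁ i ≤ inj₁ j →
            Σ[ L ∈ Rel m n ] (L ⊆ R × (¬ Gap L inj₁ inj₂ i j → Z ⊢ inj₁ i ≤ inj₁ j))
      via {L} L⊆R trim⊆Z i≤j =
        L , L⊆R , λ ¬gap → trim⊆Z _ _ (trim⁺ L (inj₁ i) (inj₁ j) (i≤j , inj₂ ¬gap))

    cover₂ : ∀ {i j} → R ⊢ inj₂ i ≤ inj₂ j →
             Σ[ L ∈ Rel m n ] (L ⊆ R × (¬ Gap L inj₂ inj₁ i j → Z ⊢ inj₂ i ≤ inj₂ j))
    cover₂ {i} {j} = Sum.[ via (breakTies-⊆ σ R) A⊆Z , via (breakTies-⊆ σ′ R) B⊆Z ]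
                   ∘ breakTies-cover σ R
      where
      via : ∀ {L} → L ⊆ R → trim L ⊆ Z → L ⊢ inj₂ i ≤ inj₂ j →
            Σ[ L ∈ Rel m n ] (L ⊆ R × (¬ Gap L inj₂ inj₁ i j → Z ⊢ inj₂ i ≤ inj₂ j))
      via {L} L⊆R trim⊆Z i≤j =
        L , L⊆R , λ ¬gap → trim⊆Z _ _ (trim⁺ L (inj₂ i) (inj₂ j) (i≤j , inj₂ ¬gap))

    R⊆Z : R ⊆ Z
    R⊆Z (inj₁ _) (inj₁ _) =
      Family.parallel-⊆ R inj₁ inj₂ R-trans R-parallel₁ Z Z-trans orthogonal₁₂ orthogonal₂₁
        (NoGapCover.noGap-⊆ R Z inj₁ inj₂ R-trans Z-trans cover₁)
    R⊆Z (inj₂ _) (inj₂ _) =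
      Family.parallel-⊆ R inj₂ inj₁ R-trans R-parallel₂ Z Z-trans orthogonal₂₁ orthogonal₁₂
        (NoGapCover.noGap-⊆ R Z inj₂ inj₁ R-trans Z-trans cover₂)
    R⊆Z (inj₁ _) (inj₂ _) = orthogonal₁₂
    R⊆Z (inj₂ _) (inj₁ _) = orthogonal₂₁

  trimmedTieBreak : (P : C m n) → C m n
  trimmedTieBreak (R , good) = trim (breakTies σ R) , trim-breakTies-isGood σ R good

  trimmedTieBreak-antisym : (P : C m n) → P ⊑ trimmedTieBreak P → Antisymmetric _≡_ (proj₁ P ⊢_≤_)
  trimmedTieBreak-antisym (R , _) R⊆A x≤y y≤x = breakTies-antisym σ R (down _ _ x≤y) (down _ _ y≤x)
    where
    down : R ⊆ breakTies σ R
    down x y = trim-⊆ (breakTies σ R) x y ∘ R⊆A x y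

trimmedTieBreaks-isJoin : {_≺_ : Coll m n → Coll m n → Set} (σ : IsStrictTotalOrder _≡_ _≺_)
                          (P : C m n) →
  IsJoin (just P) (just (trimmedTieBreak σ P)) (just (trimmedTieBreak (Flip.isStrictTotalOrder σ) P))
trimmedTieBreaks-isJoin {m} {n} σ (R , good) = lower σ , lower (Flip.isStrictTotalOrder σ) , least
  where
  lower : {_≺′_ : Coll m n → Coll m n → Set} (τ : IsStrictTotalOrder _≡_ _≺′_) →
          trim (breakTies τ R) ⊆ R
  lower τ x y = breakTies-⊆ τ R x y ∘ trim-⊆ (breakTies τ R) x y

  least : ∀ Z → just (trimmedTieBreak σ (R , good)) ⊑⊥ Z →
          just (trimmedTieBreak (Flip.isStrictTotalOrder σ) (R , good)) ⊑⊥ Z → just (R , good) ⊑⊥ Z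
  least nothing () _
  least (just (Z , Z-good)) A⊆Z B⊆Z = breakTies-least σ good Z-good A⊆Z B⊆Z

minimal⇒joinIrreducible : (P : C m n) → (∀ Q → Q ⊑ P → P ⊑ Q) → JoinIrreducible (just P)
minimal⇒joinIrreducible P minimal = proj₁ , irreducible
  where
  irreducible : ∀ a b → IsJoin (just P) a b → (just P ≈⊥ a) ⊎ (just P ≈⊥ b)
  irreducible (just Q) _ (Q⊑P , _) = inj₁ (minimal Q Q⊑P , Q⊑P)
  irreducible nothing (just Q) (_ , Q⊑P , _) = inj₂ (minimal Q Q⊑P , Q⊑P)
  irreducible nothing nothing (_ , _ , least) = ⊥-elim (least nothing tt tt)

mainTheorem7 : (m n : ℕ) → 1 ≤ m → 1 ≤ n → (P : C m n) →
    JoinIrreducible (just P) ⇔ (∀ x y → _≡R_ (proj₁ P) x y → x ≡ y)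
mainTheorem7 m n _ _ P@(R , good) = mk⇔ joinIrreducible⇒antisym antisym⇒joinIrreducible
  where
  σ : IsStrictTotalOrder _≡_ (_≺_ {m} {n})
  σ = ≺-isStrictTotalOrder {m} {n}

  joinIrreducible⇒antisym : JoinIrreducible (just P) → ∀ x y → _≡R_ R x y → x ≡ y
  joinIrreducible⇒antisym (_ , irreducible) _ _ (x≤y , y≤x) =
    Sum.[ (λ (P⊑A , _) → trimmedTieBreak-antisym σ P P⊑A x≤y y≤x)
        , (λ (P⊑B , _) → trimmedTieBreak-antisym (Flip.isStrictTotalOrder σ) P P⊑B x≤y y≤x) ]
      (irreducible _ _ (trimmedTieBreaks-isJoin σ P))

  antisym⇒joinIrreducible : (∀ x y → _≡R_ R x y → x ≡ y) → JoinIrreducible (just P)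
  antisym⇒joinIrreducible antisym = minimal⇒joinIrreducible P λ (A , A-good) A⊆R →
    antisym⇒minimal {R = R} good (λ x≤y y≤x → antisym _ _ (x≤y , y≤x)) A-good A⊆R
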